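{- Let $M$ be a metric space such that for any two points $a,c\in M$ there is at most one point $b\in M$ such that $(a,b,c)$ is a 3-term arithmetic progression. Then for every positive integer $n$, $\mu_n(M)\leq n^2-2n+2$.
   Context: For a metric space $(M,d_M)$, a triple $(a,b,c)\in M^3$ is a 3-term arithmetic progression if $d_M(a,b)=d_M(b,c)=\frac12 d_M(a,c)$ (constant triples included). For finite $A\subseteq M$, $\mathrm{AP}_3(M;A)$ is the set of such triples in $A^3$, and $\mu_n(M):=\max\{|\mathrm{AP}_3(M;A)| : A\subseteq M,\ |A|=n\}$. -}

module Defs where

open import Level using (0ℓ)
open import Data.Nat using (ℕ)
open import Data.Fin using (Fin)
open import Data.List using (List; length; filter; allFin; cartesianProduct)
open import Data.Product using (Σ; _×_; _,_; ∃)
open import Data.Sum using (_⊎_)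
open import Data.Empty using (⊥)
open import Relation.Nullary using (¬_; Dec; yes; no)
open import Relation.Binary using (Tri; tri<; tri≈; tri>)
open import Relation.Binary.PropositionalEquality using (_≡_; refl)
open import Relation.Nullary.Decidable using (_×-dec_)

-- The real numbers, given axiomatically as a complete ordered field
-- (any model; all models are isomorphic).  Equality is propositional.
record RealField : Set₁ where
  infixl 6 _+_
  infixl 7 _*_
  infix 4 _<_ _≤_ _≟_
  field
    ℝ : Set
    𝟘 𝟙 : ℝ
    _+_ _*_ : ℝ → ℝ → ℝ
    -_ : ℝ → ℝ
    _<_ : ℝ → ℝ → Set
    +-assoc : ∀ x y z → (x + y) + z ≡ x + (y + z)
    +-comm : ∀ x y → x + y ≡ y + x
    +-identity : ∀ x → 𝟘 + x ≡ x
    +-inverse : ∀ x → (- x) + x ≡ 𝟘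
    *-assoc : ∀ x y z → (x * y) * z ≡ x * (y * z)
    *-comm : ∀ x y → x * y ≡ y * x
    *-identity : ∀ x → 𝟙 * x ≡ x
    distrib : ∀ x y z → x * (y + z) ≡ x * y + x * z
    𝟘≢𝟙 : ¬ (𝟘 ≡ 𝟙)
    *-inverse : ∀ x → ¬ (x ≡ 𝟘) → Σ ℝ (λ y → y * x ≡ 𝟙)
    <-trans : ∀ {x y z} → x < y → y < z → x < z
    compare : ∀ x y → Tri (x < y) (x ≡ y) (y < x)
    +-mono-< : ∀ {x y} z → x < y → x + z < y + z
    *-pos : ∀ {x y} → 𝟘 < x → 𝟘 < y → 𝟘 < x * y
    complete : (P : ℝ → Set) → Σ ℝ P → Σ ℝ (λ u → ∀ x → P x → x < u ⊎ x ≡ u) →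
      Σ ℝ (λ s → (∀ x → P x → x < s ⊎ x ≡ s) ×
                 (∀ u → (∀ x → P x → x < u ⊎ x ≡ u) → s < u ⊎ s ≡ u))

  _≤_ : ℝ → ℝ → Set
  x ≤ y = x < y ⊎ x ≡ y

  _≟_ : (x y : ℝ) → Dec (x ≡ y)
  x ≟ y with compare x y
  ... | tri< _ ¬eq _ = no ¬eq
  ... | tri≈ _ eq _ = yes eq
  ... | tri> _ ¬eq _ = no ¬eq

record MetricSpace (R : RealField) : Set₁ where
  open RealField R
  field
    Point : Set
    d : Point → Point → ℝ
    d-nonneg : ∀ x y → 𝟘 ≤ d x y
    d-zero⇒eq : ∀ x y → d x y ≡ 𝟘 → x ≡ y
    d-refl : ∀ x → d x x ≡ 𝟘
    d-sym : ∀ x y → d x y ≡ d y x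
    d-triangle : ∀ x y z → d x z ≤ d x y + d y z

module _ {R : RealField} (M : MetricSpace R) where
  open RealField R
  open MetricSpace M

  IsAP3 : Point → Point → Point → Set
  IsAP3 a b c = (d a b ≡ d b c) × (d a c ≡ (𝟙 + 𝟙) * d a b)

  isAP3? : ∀ a b c → Dec (IsAP3 a b c)
  isAP3? a b c = (d a b ≟ d b c) ×-dec (d a c ≟ (𝟙 + 𝟙) * d a b)

  UniqueMidpoints : Set
  UniqueMidpoints = ∀ a b b′ c → IsAP3 a b c → IsAP3 a b′ c → b ≡ b′

  -- A finite subset A ⊆ M with |A| = n is given by an injective
  -- enumeration f : Fin n → Point.
  Injective : ∀ {n} → (Fin n → Point) → Set
  Injective f = ∀ i j → f i ≡ f j → i ≡ j

  -- |AP₃(M; A)| for A = image of f: number of index triples (i,j,k)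
  -- with (f i, f j, f k) a 3-term AP (a bijection with A³ since f is injective).
  countAP3 : ∀ {n} → (Fin n → Point) → ℕ
  countAP3 {n} f = length (filter (λ { (i , j , k) → isAP3? (f i) (f j) (f k) })
    (cartesianProduct (allFin n) (cartesianProduct (allFin n) (allFin n))))

-- Sorting the triples of AP₃(M; A) by their ends, each ordered pair (a, c) contributes
-- its number of midpoints in A, which is 0 or 1; hence |AP₃(M; A)| = n² − Z, where Z counts
-- the ordered pairs without a midpoint in A. Join a and c by an edge when (a, c) has no
-- midpoint. This graph is connected: across any cut, a closest crossing pair has no
-- midpoint, because a midpoint is strictly closer to both ends and so would lie on a
-- strictly closer crossing pair. A connected graph on n vertices has at least n − 1 edges
-- (grow a spanning tree as in Prim's algorithm), and each edge gives two ordered pairs, so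
-- Z ≥ 2(n − 1).
module Submission where

open import Defs
open import Level using (0ℓ)
open import Data.Bool using (Bool; true; false; _∧_; _∨_)
import Data.Bool.Properties as Boolₚ
open import Data.Nat using (ℕ; zero; suc; _+_; _*_; _∸_; _≤_; _<_; z≤n; s≤s)
import Data.Nat.Properties as ℕₚ
open import Data.Nat.Solver using (module +-*-Solver)
open import Data.Fin using (Fin; zero; suc)
import Data.Fin.Properties as Finₚ
open import Data.List using (List; []; _∷_; _++_; length; filter; map; tabulate; allFin; cartesianProduct)
import Data.List.Properties as Listₚ
import Data.List.Extrema as Extrema
open import Data.List.Membership.Propositional using (_∈_)
open import Data.List.Membership.Propositional.Properties using (∈-filter⁺; ∈-cartesianProduct⁺; ∈-allFin)
import Data.List.Relation.Unary.All as All
open import Data.List.Relation.Unary.All.Properties using (all-filter)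
open import Data.Empty using (⊥)
open import Data.Product using (Σ; _×_; _,_; ∃; ∃₂; map₂)
open import Data.Sum using (_⊎_; inj₁; inj₂)
open import Function using (_∘_)
open import Relation.Nullary using (¬_; Dec; yes; no; does; contradiction; ¬?; _×-dec_)
open import Relation.Nullary.Decidable using (dec-true)
open import Relation.Unary using (Pred; Decidable)
open import Relation.Binary using (tri<; tri≈; tri>; TotalOrder; Symmetric)
import Relation.Binary.Definitions as Binary
open import Relation.Binary.PropositionalEquality
open import Algebra.Properties.CommutativeMonoid.Sum ℕₚ.+-0-commutativeMonoid
  using (sum-syntax; sum-cong-≗; sum-remove; ∑-distrib-+; ∑-comm)

∑-mono-≤ : ∀ {n} {f g : Fin n → ℕ} → (∀ i → f i ≤ g i) → ∑[ i < n ] f i ≤ ∑[ i < n ] g i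
∑-mono-≤ {zero} _ = z≤n
∑-mono-≤ {suc n} f≤g = ℕₚ.+-mono-≤ (f≤g zero) (∑-mono-≤ (f≤g ∘ suc))

∑-const : ∀ n c → ∑[ i < n ] c ≡ n * c
∑-const zero c = refl
∑-const (suc n) c = cong (c +_) (∑-const n c)

f[i]≤∑f : ∀ {n} (f : Fin n → ℕ) i → f i ≤ ∑[ j < n ] f j
f[i]≤∑f {suc n} f i = subst (f i ≤_) (sym (sum-remove {i = i} f)) (ℕₚ.m≤m+n (f i) _)

f[i,k]≤∑∑f : ∀ {m n} (f : Fin m → Fin n → ℕ) i k → f i k ≤ ∑[ i < m ] ∑[ k < n ] f i k
f[i,k]≤∑∑f f i k = ℕₚ.≤-trans (f[i]≤∑f (f i) k) (f[i]≤∑f (λ i → ∑[ k < _ ] f i k) i)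

∑∑-distrib-+ : ∀ {m n} (f g : Fin m → Fin n → ℕ) →
  ∑[ i < m ] ∑[ k < n ] (f i k + g i k) ≡ ∑[ i < m ] ∑[ k < n ] f i k + ∑[ i < m ] ∑[ k < n ] g i k
∑∑-distrib-+ f g = trans (sum-cong-≗ (λ i → ∑-distrib-+ (f i) (g i)))
                          (∑-distrib-+ (λ i → ∑[ k < _ ] f i k) (λ i → ∑[ k < _ ] g i k))

xx′z+xy′z+yx′z≤[x+y][x′+y′]z : ∀ x y x′ y′ z →
  x * (x′ * z) + (x * (y′ * z) + y * (x′ * z)) ≤ (x + y) * ((x′ + y′) * z)
xx′z+xy′z+yx′z≤[x+y][x′+y′]z x y x′ y′ z =
  ℕₚ.≤-trans (ℕₚ.m≤m+n _ (y * (y′ * z))) (ℕₚ.≤-reflexive (expansion x y x′ y′ z))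
  where
  open +-*-Solver using (solve; _:+_; _:*_; _:=_)
  expansion : ∀ x y x′ y′ z →
    x * (x′ * z) + (x * (y′ * z) + y * (x′ * z)) + y * (y′ * z) ≡ (x + y) * ((x′ + y′) * z)
  expansion = solve 5 (λ x y x′ y′ z →
    x :* (x′ :* z) :+ (x :* (y′ :* z) :+ y :* (x′ :* z)) :+ y :* (y′ :* z)
    := (x :+ y) :* ((x′ :+ y′) :* z)) refl

bit : Bool → ℕ
bit true = 1
bit false = 0

bit*≤ : ∀ b x → bit b * x ≤ x
bit*≤ true x = ℕₚ.≤-reflexive (ℕₚ.+-identityʳ x)
bit*≤ false x = z≤n

bit-∨ : ∀ b c → b ∧ c ≡ false → bit (b ∨ c) ≡ bit b + bit c
bit-∨ true false _ = refl
bit-∨ false true _ = refl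
bit-∨ false false _ = refl

bit*bit*bit≡1 : ∀ {b c e} → b ≡ true → c ≡ true → e ≡ true → bit b * (bit c * bit e) ≡ 1
bit*bit*bit≡1 refl refl refl = refl

size : ∀ {n} → (Fin n → Bool) → ℕ
size {n} S = ∑[ i < n ] bit (S i)

count : ∀ {n p} {P : Pred (Fin n) p} → Decidable P → ℕ
count P? = size (λ i → does (P? i))

count-none : ∀ {n p} {P : Pred (Fin n) p} (P? : Decidable P) → (∀ i → ¬ P i) → count P? ≡ 0
count-none {zero} P? ¬P = refl
count-none {suc n} P? ¬P with P? zero
... | yes p = contradiction p (¬P zero)
... | no _ = count-none (P? ∘ suc) (¬P ∘ suc)

count-witness : ∀ {n p} {P : Pred (Fin n) p} (P? : Decidable P) {i} → P i → 1 ≤ count P?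
count-witness P? {i} p =
  ℕₚ.≤-trans (ℕₚ.≤-reflexive (cong bit (sym (dec-true (P? i) p)))) (f[i]≤∑f _ i)

count-unique : ∀ {n p} {P : Pred (Fin n) p} (P? : Decidable P) →
  (∀ {i j} → P i → P j → i ≡ j) → count P? ≤ 1
count-unique {zero} P? unique = z≤n
count-unique {suc n} P? unique with P? zero
... | yes p = s≤s (ℕₚ.≤-reflexive (count-none (P? ∘ suc) (λ i q → Finₚ.0≢1+n (unique p q))))
... | no _ = count-unique (P? ∘ suc) (λ p q → Finₚ.suc-injective (unique p q))

module _ {a p} {A : Set a} {P : Pred A p} (P? : Decidable P) where

  length-filter-map : ∀ {b} {B : Set b} (h : B → A) xs →
    length (filter P? (map h xs)) ≡ length (filter (P? ∘ h) xs)
  length-filter-map h [] = refl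
  length-filter-map h (x ∷ xs) with does (P? (h x))
  ... | true = cong suc (length-filter-map h xs)
  ... | false = length-filter-map h xs

  length-filter-tabulate : ∀ {n} (g : Fin n → A) → length (filter P? (tabulate g)) ≡ count (P? ∘ g)
  length-filter-tabulate {zero} g = refl
  length-filter-tabulate {suc n} g with does (P? (g zero))
  ... | true = cong suc (length-filter-tabulate (g ∘ suc))
  ... | false = length-filter-tabulate (g ∘ suc)

module _ {a b p} {A : Set a} {B : Set b} {P : Pred (A × B) p} (P? : Decidable P) where

  length-filter-cartesianProduct : ∀ {n} (g : Fin n → A) ys →
    length (filter P? (cartesianProduct (tabulate g) ys)) ≡
    ∑[ i < n ] length (filter (λ y → P? (g i , y)) ys)
  length-filter-cartesianProduct {zero} g ys = refl
  length-filter-cartesianProduct {suc n} g ys = begin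
    length (filter P? (map (g zero ,_) ys ++ rest))
      ≡⟨ cong length (Listₚ.filter-++ P? (map (g zero ,_) ys) rest) ⟩
    length (filter P? (map (g zero ,_) ys) ++ filter P? rest)
      ≡⟨ Listₚ.length-++ (filter P? (map (g zero ,_) ys)) ⟩
    length (filter P? (map (g zero ,_) ys)) + length (filter P? rest)
      ≡⟨ cong₂ _+_ (length-filter-map P? (g zero ,_) ys) (length-filter-cartesianProduct (g ∘ suc) ys) ⟩
    length (filter (λ y → P? (g zero , y)) ys) + ∑[ i < n ] length (filter (λ y → P? (g (suc i) , y)) ys)
      ∎
    where
    open ≡-Reasoning
    rest : List (A × B)
    rest = cartesianProduct (tabulate (g ∘ suc)) ys

⁅_⁆ : ∀ {n} → Fin n → Fin n → Bool
⁅ v ⁆ i = does (i Finₚ.≟ v)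

_∪_ : ∀ {n} → (Fin n → Bool) → (Fin n → Bool) → Fin n → Bool
(S ∪ T) i = S i ∨ T i

size-⁅⁆ : ∀ {n} (v : Fin n) → size ⁅ v ⁆ ≡ 1
size-⁅⁆ v = ℕₚ.≤-antisym
  (count-unique (λ i → i Finₚ.≟ v) (λ i≡v j≡v → trans i≡v (sym j≡v)))
  (count-witness (λ i → i Finₚ.≟ v) refl)

size-∪ : ∀ {n} (S T : Fin n → Bool) → (∀ i → S i ∧ T i ≡ false) →
  size (S ∪ T) ≡ size S + size T
size-∪ S T disjoint =
  trans (sum-cong-≗ (λ i → bit-∨ (S i) (T i) (disjoint i))) (∑-distrib-+ (bit ∘ S) (bit ∘ T))

disjoint-⁅⁆ : ∀ {n} (S : Fin n → Bool) {v} → S v ≡ false → ∀ i → S i ∧ ⁅ v ⁆ i ≡ false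
disjoint-⁅⁆ S {v} Sv≡false i with i Finₚ.≟ v
... | yes refl = trans (Boolₚ.∧-identityʳ (S i)) Sv≡false
... | no _ = Boolₚ.∧-zeroʳ (S i)

size<n⇒∃false : ∀ {n} (S : Fin n → Bool) → size S < n → ∃ λ v → S v ≡ false
size<n⇒∃false {n} S size<n =
  map₂ Boolₚ.¬-not (Finₚ.¬∀⟶∃¬ n (λ i → S i ≡ true) (λ i → S i Boolₚ.≟ true) not-all-true)
  where
  not-all-true : ¬ (∀ i → S i ≡ true)
  not-all-true all-true = ℕₚ.<-irrefl size≡n size<n
    where
    size≡n : size S ≡ n
    size≡n = trans (sum-cong-≗ (λ i → cong bit (all-true i))) (trans (∑-const n 1) (ℕₚ.*-identityʳ n))

Connected : ∀ {n} → (Fin n → Fin n → Set) → Set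
Connected {n} E = ∀ (S : Fin n → Bool) {u v} → S u ≡ true → S v ≡ false →
  ∃₂ λ x y → S x ≡ true × S y ≡ false × E x y

module _ {n} {E : Fin n → Fin n → Set} (E? : Binary.Decidable E) where

  edgeCount : ℕ
  edgeCount = ∑[ i < n ] ∑[ k < n ] bit (does (E? i k))

  edgesWithin : (Fin n → Bool) → ℕ
  edgesWithin S = ∑[ i < n ] ∑[ k < n ] (bit (S i) * (bit (S k) * bit (does (E? i k))))

  edgesWithin≤edgeCount : ∀ S → edgesWithin S ≤ edgeCount
  edgesWithin≤edgeCount S = ∑-mono-≤ λ i → ∑-mono-≤ λ k →
    ℕₚ.≤-trans (bit*≤ (S i) _) (bit*≤ (S k) _)

  -- As v ∉ S, the indicator of S ∪ ⁅ v ⁆ is that of S plus that of ⁅ v ⁆; expanding the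
  -- products gives the edges within S plus cross terms, among them (u, v) and (v, u).
  edgesWithin-∪⁅⁆ : ∀ S {u v} → S u ≡ true → S v ≡ false → E u v → E v u →
    edgesWithin S + 2 ≤ edgesWithin (S ∪ ⁅ v ⁆)
  edgesWithin-∪⁅⁆ S {u} {v} Su Sv Euv Evu = begin
    edgesWithin S + 2
      ≡⟨ cong (edgesWithin S +_) (cong₂ _+_ B[u,v]≡1 C[v,u]≡1) ⟨
    edgesWithin S + (B u v + C v u)
      ≤⟨ ℕₚ.+-monoʳ-≤ (edgesWithin S) (ℕₚ.+-mono-≤ (f[i,k]≤∑∑f B u v) (f[i,k]≤∑∑f C v u)) ⟩
    edgesWithin S + (∑∑ B + ∑∑ C)
      ≡⟨ cong (edgesWithin S +_) (∑∑-distrib-+ B C) ⟨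
    edgesWithin S + ∑∑ (λ i k → B i k + C i k)
      ≡⟨ ∑∑-distrib-+ A (λ i k → B i k + C i k) ⟨
    ∑∑ (λ i k → A i k + (B i k + C i k))
      ≤⟨ ∑-mono-≤ (λ i → ∑-mono-≤ (λ k → expansion i k)) ⟩
    edgesWithin (S ∪ ⁅ v ⁆)
      ∎
    where
    open ℕₚ.≤-Reasoning
    ∑∑ : (Fin n → Fin n → ℕ) → ℕ
    ∑∑ f = ∑[ i < n ] ∑[ k < n ] f i k
    a e : Fin n → ℕ
    a i = bit (S i)
    e i = bit (⁅ v ⁆ i)
    A B C : Fin n → Fin n → ℕ
    A i k = a i * (a k * bit (does (E? i k)))
    B i k = a i * (e k * bit (does (E? i k)))
    C i k = e i * (a k * bit (does (E? i k)))
    B[u,v]≡1 : B u v ≡ 1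
    B[u,v]≡1 = bit*bit*bit≡1 Su (dec-true (v Finₚ.≟ v) refl) (dec-true (E? u v) Euv)
    C[v,u]≡1 : C v u ≡ 1
    C[v,u]≡1 = bit*bit*bit≡1 (dec-true (v Finₚ.≟ v) refl) Su (dec-true (E? v u) Evu)
    bit-∪⁅⁆ : ∀ i → bit ((S ∪ ⁅ v ⁆) i) ≡ a i + e i
    bit-∪⁅⁆ i = bit-∨ (S i) (⁅ v ⁆ i) (disjoint-⁅⁆ S Sv i)
    expansion : ∀ i k → A i k + (B i k + C i k) ≤
                        bit ((S ∪ ⁅ v ⁆) i) * (bit ((S ∪ ⁅ v ⁆) k) * bit (does (E? i k)))
    expansion i k = subst (A i k + (B i k + C i k) ≤_)
      (sym (cong₂ (λ p q → p * (q * bit (does (E? i k)))) (bit-∪⁅⁆ i) (bit-∪⁅⁆ k)))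
      (xx′z+xy′z+yx′z≤[x+y][x′+y′]z (a i) (e i) (a k) (e k) (bit (does (E? i k))))

module _ {m} {E : Fin (suc m) → Fin (suc m) → Set} (E? : Binary.Decidable E)
         (E-sym : Symmetric E) (connected : Connected E) where

  -- Prim's algorithm: S is the vertex set of the tree grown so far.
  growTree : ∀ s → s ≤ m → Σ (Fin (suc m) → Bool) λ S →
    S zero ≡ true × size S ≡ suc s × 2 * s ≤ edgesWithin E? S
  growTree zero _ = ⁅ zero ⁆ , refl , size-⁅⁆ {suc m} zero , z≤n
  growTree (suc s) s<m with growTree s (ℕₚ.<⇒≤ s<m)
  ... | S , S-root , size≡ , 2s≤edges with size<n⇒∃false S (subst (_< suc m) (sym size≡) (s≤s s<m))
  ... | v₀ , Sv₀ with connected S S-root Sv₀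
  ... | u , v , Su , Sv , Euv = S ∪ ⁅ v ⁆ , cong (_∨ ⁅ v ⁆ zero) S-root , size-grows , edges-grow
    where
    size-grows : size (S ∪ ⁅ v ⁆) ≡ suc (suc s)
    size-grows = begin
      size (S ∪ ⁅ v ⁆)      ≡⟨ size-∪ S ⁅ v ⁆ (disjoint-⁅⁆ S Sv) ⟩
      size S + size ⁅ v ⁆   ≡⟨ cong₂ _+_ size≡ (size-⁅⁆ v) ⟩
      suc s + 1             ≡⟨ ℕₚ.+-comm (suc s) 1 ⟩
      suc (suc s)           ∎
      where open ≡-Reasoning
    edges-grow : 2 * suc s ≤ edgesWithin E? (S ∪ ⁅ v ⁆)
    edges-grow = begin
      2 * suc s                 ≡⟨ trans (ℕₚ.*-suc 2 s) (ℕₚ.+-comm 2 (2 * s)) ⟩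
      2 * s + 2                 ≤⟨ ℕₚ.+-monoˡ-≤ 2 2s≤edges ⟩
      edgesWithin E? S + 2      ≤⟨ edgesWithin-∪⁅⁆ E? S Su Sv Euv (E-sym Euv) ⟩
      edgesWithin E? (S ∪ ⁅ v ⁆) ∎
      where open ℕₚ.≤-Reasoning

  connected⇒2m≤edgeCount : 2 * m ≤ edgeCount E?
  connected⇒2m≤edgeCount with growTree m ℕₚ.≤-refl
  ... | S , _ , _ , 2m≤edges = ℕₚ.≤-trans 2m≤edges (edgesWithin≤edgeCount E? S)

module OrderedFieldProperties (R : RealField) where
  open RealField R using (ℝ; 𝟘; 𝟙; compare; *-comm; *-identity; distrib; +-identity)
    renaming (_+_ to _+ℝ_; _*_ to _*ℝ_; _<_ to _<ℝ_; _≤_ to _≤ℝ_;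
              <-trans to <ℝ-trans; +-mono-< to +ℝ-mono-<)

  <ℝ-irrefl : ∀ {x} → ¬ (x <ℝ x)
  <ℝ-irrefl {x} with compare x x
  ... | tri< _ _ x≮x = x≮x
  ... | tri≈ x≮x _ _ = x≮x
  ... | tri> x≮x _ _ = x≮x

  <⇒≱ : ∀ {x y} → x <ℝ y → ¬ (y ≤ℝ x)
  <⇒≱ x<y (inj₁ y<x) = <ℝ-irrefl (<ℝ-trans x<y y<x)
  <⇒≱ x<y (inj₂ refl) = <ℝ-irrefl x<y

  ≤ℝ-trans : ∀ {x y z} → x ≤ℝ y → y ≤ℝ z → x ≤ℝ z
  ≤ℝ-trans (inj₁ x<y) (inj₁ y<z) = inj₁ (<ℝ-trans x<y y<z)
  ≤ℝ-trans (inj₁ x<y) (inj₂ refl) = inj₁ x<y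
  ≤ℝ-trans (inj₂ refl) y≤z = y≤z

  ≤ℝ-antisym : ∀ {x y} → x ≤ℝ y → y ≤ℝ x → x ≡ y
  ≤ℝ-antisym (inj₂ x≡y) _ = x≡y
  ≤ℝ-antisym (inj₁ x<y) y≤x = contradiction y≤x (<⇒≱ x<y)

  ≤ℝ-total : ∀ x y → x ≤ℝ y ⊎ y ≤ℝ x
  ≤ℝ-total x y with compare x y
  ... | tri< x<y _ _ = inj₁ (inj₁ x<y)
  ... | tri≈ _ x≡y _ = inj₁ (inj₂ x≡y)
  ... | tri> _ _ y<x = inj₂ (inj₁ y<x)

  ≤ℝ-totalOrder : TotalOrder 0ℓ 0ℓ 0ℓ
  ≤ℝ-totalOrder = record
    { isTotalOrder = record
      { isPartialOrder = record
        { isPreorder = record { isEquivalence = isEquivalence ; reflexive = inj₂ ; trans = ≤ℝ-trans }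
        ; antisym = ≤ℝ-antisym }
      ; total = ≤ℝ-total } }

  x<[𝟙+𝟙]*x : ∀ {x} → 𝟘 <ℝ x → x <ℝ (𝟙 +ℝ 𝟙) *ℝ x
  x<[𝟙+𝟙]*x {x} 0<x = subst₂ _<ℝ_ (+-identity x) (sym [𝟙+𝟙]*x≡x+x) (+ℝ-mono-< x 0<x)
    where
    open ≡-Reasoning
    x*𝟙≡x : x *ℝ 𝟙 ≡ x
    x*𝟙≡x = trans (*-comm x 𝟙) (*-identity x)
    [𝟙+𝟙]*x≡x+x : (𝟙 +ℝ 𝟙) *ℝ x ≡ x +ℝ x
    [𝟙+𝟙]*x≡x+x = begin
      (𝟙 +ℝ 𝟙) *ℝ x          ≡⟨ *-comm (𝟙 +ℝ 𝟙) x ⟩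
      x *ℝ (𝟙 +ℝ 𝟙)          ≡⟨ distrib x 𝟙 𝟙 ⟩
      x *ℝ 𝟙 +ℝ x *ℝ 𝟙       ≡⟨ cong₂ _+ℝ_ x*𝟙≡x x*𝟙≡x ⟩
      x +ℝ x                 ∎

  module _ {a p} {A : Set a} {P : Pred A p} (P? : Decidable P) (key : A → ℝ) where
    open Extrema ≤ℝ-totalOrder using (argmin; argmin-all; f[argmin]≤f[xs])

    minimal-witness : ∀ xs {x₀} → P x₀ →
      Σ A λ x → P x × (∀ {y} → y ∈ xs → P y → key x ≤ℝ key y)
    minimal-witness xs {x₀} Px₀ =
      argmin key x₀ (filter P? xs) ,
      argmin-all key Px₀ (all-filter P? xs) ,
      λ y∈xs Py → All.lookup (f[argmin]≤f[xs] {f = key} x₀ (filter P? xs)) (∈-filter⁺ P? y∈xs Py)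

module MetricProperties {R : RealField} (M : MetricSpace R) where
  open RealField R using (𝟘; 𝟙) renaming (_+_ to _+ℝ_; _*_ to _*ℝ_; _<_ to _<ℝ_)
  open MetricSpace M
  open OrderedFieldProperties R using (x<[𝟙+𝟙]*x)

  IsAP3-sym : ∀ {a b c} → IsAP3 M a b c → IsAP3 M c b a
  IsAP3-sym {a} {b} {c} (dab≡dbc , dac≡2dab) =
    trans (d-sym c b) (trans (sym dab≡dbc) (d-sym a b)) ,
    trans (d-sym c a) (trans dac≡2dab (cong ((𝟙 +ℝ 𝟙) *ℝ_) (trans dab≡dbc (d-sym b c))))

  -- If d a b were 0 then a = b, and d a c = d b c = d a b = 0 would force a = c.
  IsAP3⇒d[a,b]<d[a,c] : ∀ {a b c} → a ≢ c → IsAP3 M a b c → d a b <ℝ d a c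
  IsAP3⇒d[a,b]<d[a,c] {a} {b} {c} a≢c (dab≡dbc , dac≡2dab) with d-nonneg a b
  ... | inj₁ 0<dab = subst (d a b <ℝ_) (sym dac≡2dab) (x<[𝟙+𝟙]*x 0<dab)
  ... | inj₂ 0≡dab = contradiction (d-zero⇒eq a c dac≡0) a≢c
    where
    dac≡0 : d a c ≡ 𝟘
    dac≡0 = trans (cong (λ x → d x c) (d-zero⇒eq a b (sym 0≡dab))) (trans (sym dab≡dbc) (sym 0≡dab))

module Configuration {R : RealField} (M : MetricSpace R) {n} (f : Fin n → MetricSpace.Point M) where
  open RealField R using (ℝ) renaming (_<_ to _<ℝ_)
  open MetricSpace M
  open OrderedFieldProperties R using (<⇒≱; minimal-witness)
  open MetricProperties M

  AP : Fin n → Fin n → Fin n → Set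
  AP i j k = IsAP3 M (f i) (f j) (f k)

  AP? : ∀ i j k → Dec (AP i j k)
  AP? i j k = isAP3? M (f i) (f j) (f k)

  midpointCount : Fin n → Fin n → ℕ
  midpointCount i k = count (λ j → AP? i j k)

  NoMidpoint : Fin n → Fin n → Set
  NoMidpoint i k = ¬ ∃ λ j → AP i j k

  noMidpoint? : Binary.Decidable NoMidpoint
  noMidpoint? i k = ¬? (Finₚ.any? (λ j → AP? i j k))

  countAP3≡∑∑midpointCount : countAP3 M f ≡ ∑[ i < n ] ∑[ k < n ] midpointCount i k
  countAP3≡∑∑midpointCount = begin
    countAP3 M f
      ≡⟨ length-filter-cartesianProduct AP?′ (λ i → i) (cartesianProduct (allFin n) (allFin n)) ⟩
    ∑[ i < n ] length (filter (λ jk → AP?′ (i , jk)) (cartesianProduct (allFin n) (allFin n)))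
      ≡⟨ sum-cong-≗ (λ i →
           length-filter-cartesianProduct (λ jk → AP?′ (i , jk)) (λ j → j) (allFin n)) ⟩
    ∑[ i < n ] ∑[ j < n ] length (filter (λ k → AP? i j k) (allFin n))
      ≡⟨ sum-cong-≗ (λ i → sum-cong-≗ (λ j → length-filter-tabulate (AP? i j) (λ k → k))) ⟩
    ∑[ i < n ] ∑[ j < n ] ∑[ k < n ] bit (does (AP? i j k))
      ≡⟨ sum-cong-≗ (λ i → ∑-comm (λ j k → bit (does (AP? i j k)))) ⟩
    ∑[ i < n ] ∑[ k < n ] midpointCount i k
      ∎
    where
    open ≡-Reasoning
    AP?′ : Decidable {A = Fin n × Fin n × Fin n} (λ { (i , j , k) → AP i j k })
    AP?′ (i , j , k) = AP? i j k

  midpointCount+[noMidpoint]≡1 : UniqueMidpoints M → Injective M f →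
    ∀ i k → midpointCount i k + bit (does (noMidpoint? i k)) ≡ 1
  midpointCount+[noMidpoint]≡1 unique inj i k with Finₚ.any? (λ j → AP? i j k)
  ... | yes (j , ap) = trans (ℕₚ.+-identityʳ _)
    (ℕₚ.≤-antisym (count-unique (λ j → AP? i j k) (λ {j} {j′} p q → inj j j′ (unique _ _ _ _ p q)))
                  (count-witness (λ j → AP? i j k) ap))
  ... | no none = cong (_+ 1) (count-none (λ j → AP? i j k) (λ j ap → none (j , ap)))

  countAP3+edgeCount≡n*n : UniqueMidpoints M → Injective M f → countAP3 M f + edgeCount noMidpoint? ≡ n * n
  countAP3+edgeCount≡n*n unique inj = begin
    countAP3 M f + edgeCount noMidpoint?
      ≡⟨ cong (_+ edgeCount noMidpoint?) countAP3≡∑∑midpointCount ⟩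
    ∑[ i < n ] ∑[ k < n ] midpointCount i k + edgeCount noMidpoint?
      ≡⟨ ∑∑-distrib-+ midpointCount (λ i k → bit (does (noMidpoint? i k))) ⟨
    ∑[ i < n ] ∑[ k < n ] (midpointCount i k + bit (does (noMidpoint? i k)))
      ≡⟨ sum-cong-≗ (λ i → trans (sum-cong-≗ (midpointCount+[noMidpoint]≡1 unique inj i)) ∑1≡n) ⟩
    ∑[ i < n ] n
      ≡⟨ ∑-const n n ⟩
    n * n
      ∎
    where
    open ≡-Reasoning
    ∑1≡n : ∑[ k < n ] 1 ≡ n
    ∑1≡n = trans (∑-const n 1) (ℕₚ.*-identityʳ n)

  noMidpoint-sym : Symmetric NoMidpoint
  noMidpoint-sym none (j , ap) = none (j , IsAP3-sym ap)

  private
    Crossing : (Fin n → Bool) → Fin n × Fin n → Set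
    Crossing S (x , y) = S x ≡ true × S y ≡ false

    crossing? : ∀ S → Decidable (Crossing S)
    crossing? S (x , y) = (S x Boolₚ.≟ true) ×-dec (S y Boolₚ.≟ false)

    gap : Fin n × Fin n → ℝ
    gap (x , y) = d (f x) (f y)

    pairs : List (Fin n × Fin n)
    pairs = cartesianProduct (allFin n) (allFin n)

    pair∈pairs : ∀ x y → (x , y) ∈ pairs
    pair∈pairs x y = ∈-cartesianProduct⁺ (∈-allFin x) (∈-allFin y)

  noMidpoint-connected : Injective M f → Connected NoMidpoint
  noMidpoint-connected inj S Su₀ Sv₀ with minimal-witness (crossing? S) gap pairs (Su₀ , Sv₀)
  ... | (u , v) , (Su , Sv) , closest = u , v , Su , Sv , λ (j , ap) → midpoint⇒closer-crossing j ap
    where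
    fu≢fv : f u ≢ f v
    fu≢fv fu≡fv = Boolₚ.not-¬ Su (subst (λ w → S w ≡ false) (sym (inj u v fu≡fv)) Sv)
    midpoint⇒closer-crossing : ∀ j → AP u j v → ⊥
    midpoint⇒closer-crossing j ap@(duj≡djv , _) with S j Boolₚ.≟ true
    ... | yes Sj = <⇒≱ (subst (_<ℝ gap (u , v)) duj≡djv (IsAP3⇒d[a,b]<d[a,c] fu≢fv ap))
                       (closest (pair∈pairs j v) (Sj , Sv))
    ... | no Sj≢true = <⇒≱ (IsAP3⇒d[a,b]<d[a,c] fu≢fv ap)
                          (closest (pair∈pairs u j) (Su , Boolₚ.¬-not Sj≢true))

m+n≡o⇒m≤o∸k : ∀ {m n o k} → m + n ≡ o → k ≤ n → m ≤ o ∸ k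
m+n≡o⇒m≤o∸k {m} {n} {o} {k} m+n≡o k≤n = begin
  m             ≡⟨ ℕₚ.m+n∸n≡m m n ⟨
  m + n ∸ n     ≡⟨ cong (_∸ n) m+n≡o ⟩
  o ∸ n         ≤⟨ ℕₚ.∸-monoʳ-≤ o k≤n ⟩
  o ∸ k         ∎
  where open ℕₚ.≤-Reasoning

[o+2]∸2[1+k]≡o∸2k : ∀ o k → (o + 2) ∸ (2 * suc k) ≡ o ∸ 2 * k
[o+2]∸2[1+k]≡o∸2k o k = begin
  (o + 2) ∸ (2 * suc k)   ≡⟨ cong₂ _∸_ (ℕₚ.+-comm o 2) (ℕₚ.*-suc 2 k) ⟩
  (2 + o) ∸ (2 + 2 * k)   ≡⟨ ℕₚ.[m+n]∸[m+o]≡n∸o 2 o (2 * k) ⟩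
  o ∸ 2 * k               ∎
  where open ≡-Reasoning

claim2p2 : (R : RealField) (M : MetricSpace R) → UniqueMidpoints M →
    (n : ℕ) → 1 ≤ n → (f : Fin n → MetricSpace.Point M) → Injective M f →
    countAP3 M f ≤ (n * n + 2) ∸ (2 * n)
claim2p2 R M unique (suc m) _ f inj =
  subst (countAP3 M f ≤_) (sym ([o+2]∸2[1+k]≡o∸2k (suc m * suc m) m))
    (m+n≡o⇒m≤o∸k (countAP3+edgeCount≡n*n unique inj)
      (connected⇒2m≤edgeCount noMidpoint? noMidpoint-sym (noMidpoint-connected inj)))
  where open Configuration M f
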